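{- Let $S^{UDD}(1)<S^{UDD}(2)<\cdots$ be the increasing enumeration of all integers $N\ge1$ with $F^{UDD}(N)=1$. Then $S^{UDD}(2m+1)=3^m$ for all $m\ge0$ and $S^{UDD}(2m)=2\cdot 3^{m-1}$ for all $m\ge1$.
   Context: $UDD$ denotes the periodic dealing pattern $UDDUDDUDD\cdots$. Dealing a deck of $N$ cards (positions $1,\dots,N$ from the top) by a pattern means: process the letters in order; for a $U$ move the top card to the bottom; for a $D$ remove the top card (deal it); stop when all $N$ cards are dealt. $F^{UDD}(N)$ is the initial position of the last card dealt when dealing $N$ cards by $UDD$. -}

module Defs where

open import Data.Nat using (ℕ; zero; suc; _+_; _*_; _%_; _≤_; _≟_)
open import Data.List using (List; []; _∷_; _++_; [_]; map; upTo)
open import Data.Bool using (if_then_else_)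
open import Data.Product using (_×_)
open import Relation.Nullary using (does)
open import Relation.Binary.PropositionalEquality using (_≡_)

data Letter : Set where
  U D : Letter

UDD : ℕ → Letter
UDD i with i % 3
... | zero = U
... | suc _ = D

-- Arguments: fuel (bound on number of letters
-- processed), index of next letter, current deck (top first, entries are the
-- initial positions of the cards), and the initial position of the last card
-- dealt so far.
-- Each letter either moves or deals; with UDD at most 3N letters are needed
-- for N cards, so fuel 3N suffices.
run : (ℕ → Letter) → ℕ → ℕ → List ℕ → ℕ → ℕ
run p _ _ [] last = last
run p zero _ (_ ∷ _) last = last
run p (suc f) i (x ∷ xs) last with p i
... | U = run p f (suc i) (xs ++ [ x ]) last
... | D = run p f (suc i) xs x

deck : ℕ → List ℕ
deck N = map suc (upTo N)

F-UDD : ℕ → ℕ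
F-UDD N = run UDD (3 * N) 0 (deck N) 0

count1 : ℕ → ℕ
count1 zero = 0
count1 (suc n) = count1 n + (if does (F-UDD (suc n) ≟ 1) then 1 else 0)

-- S^{UDD}(k) ≡ N : N is the k-th element (k ≥ 1) of the increasing
-- enumeration of {N ≥ 1 | F^{UDD}(N) = 1}.
S-UDD-is : ℕ → ℕ → Set
S-UDD-is k N = (1 ≤ N) × (F-UDD N ≡ 1) × (count1 N ≡ k)

{-# OPTIONS --safe #-}
{-
Dealing UDD from a deck of N + 2 cards puts card 1 underneath and deals cards 2
and 3, leaving the N-card deck 4, …, N + 2, 1 with the pattern back at its start.
Hence F(N + 2) = 1 if F(N) = N, and F(N + 2) = F(N) + 3 otherwise. Starting from
F(N) = 1 this gives F(N + 2j) = 1 + 3j for j < N: never 1 again for j > 0, and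
equal to N + 2j exactly at j = N - 1, so F(3N) = 1. Together with F(1) = F(2) = 1
the solutions of F(N) = 1 are thus S 0 = 1, S 1 = 2, S (k + 2) = 3 S k, and there
are no others because the blocks S k + 2j (j < S k) cover all positive integers.
-}
module Submission where

open import Data.Bool using (if_then_else_)
open import Data.List using ([]; _∷_; [_]; _∷ʳ_; map; length; upTo; applyUpTo)
open import Data.List.Properties using (map-++; length-++; length-map; length-upTo; map-cong-local; map-upTo; map-applyUpTo; upTo-∷ʳ)
open import Data.List.Relation.Unary.All.Properties using (applyUpTo⁺₁)
open import Data.Nat
open import Data.Nat.Properties
open import Data.Nat.Tactic.RingSolver using (solve-∀)
open import Data.Product using (∃; ∃₂; _×_; _,_)
open import Data.Sum using (inj₁; inj₂)
open import Relation.Binary.PropositionalEquality using (_≡_; _≢_; refl; sym; trans; cong; cong₂; subst; subst₂; module ≡-Reasoning)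
open import Relation.Nullary using (does; yes; no)
open import Relation.Nullary.Decidable using (dec-true; dec-false)

open import Defs

open ≡-Reasoning

run-periodic : ∀ {p} k → (∀ i → p (k + i) ≡ p i) →
               ∀ f i xs l → run p f (k + i) xs l ≡ run p f i xs l
run-periodic k per f i [] l = refl
run-periodic k per zero i (x ∷ xs) l = refl
run-periodic {p} k per (suc f) i (x ∷ xs) l rewrite per i with p i
... | U = trans (cong (λ j → run p f j (xs ∷ʳ x) l) (sym (+-suc k i))) (run-periodic k per f (suc i) (xs ∷ʳ x) l)
... | D = trans (cong (λ j → run p f j xs x) (sym (+-suc k i))) (run-periodic k per f (suc i) xs x)

run-map : ∀ p (g : ℕ → ℕ) f i xs l → run p f i (map g xs) (g l) ≡ g (run p f i xs l)
run-map p g f i [] l = refl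
run-map p g zero i (x ∷ xs) l = refl
run-map p g (suc f) i (x ∷ xs) l with p i
... | U rewrite sym (map-++ g xs [ x ]) = run-map p g f (suc i) (xs ∷ʳ x) l
... | D = run-map p g f (suc i) xs x

run-UDD-round : ∀ f x y z ws l → run UDD (3 + f) 0 (x ∷ y ∷ z ∷ ws) l ≡ run UDD f 0 (ws ∷ʳ x) z
run-UDD-round f x y z ws l = run-periodic 3 (λ _ → refl) f 0 (ws ∷ʳ x) z

fuel-after-round : ∀ n → 3 * suc n + 3 ≡ n + 2 * (3 + n)
fuel-after-round = solve-∀

run-UDD-fuel : ∀ f k xs l → 3 * length xs ≤ f → run UDD (f + k) 0 xs l ≡ run UDD f 0 xs l
run-UDD-fuel f k [] l _ = refl
run-UDD-fuel _ k (x ∷ []) l (s≤s (s≤s (s≤s _))) = refl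
run-UDD-fuel _ k (x ∷ y ∷ []) l (s≤s (s≤s (s≤s _))) = refl
run-UDD-fuel (suc (suc (suc f))) k (x ∷ y ∷ z ∷ ws) l (s≤s (s≤s (s≤s p))) = begin
  run UDD (3 + (f + k)) 0 (x ∷ y ∷ z ∷ ws) l  ≡⟨ run-UDD-round (f + k) x y z ws l ⟩
  run UDD (f + k) 0 (ws ∷ʳ x) z               ≡⟨ run-UDD-fuel f k (ws ∷ʳ x) z fuel-left ⟩
  run UDD f 0 (ws ∷ʳ x) z                     ≡⟨ run-UDD-round f x y z ws l ⟨
  run UDD (3 + f) 0 (x ∷ y ∷ z ∷ ws) l        ∎
  where
  fuel-left : 3 * length (ws ∷ʳ x) ≤ f
  fuel-left = ≤-trans (≤-reflexive (cong (3 *_) (trans (length-++ ws) (+-comm _ 1))))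
                (≤-trans (m≤m+n _ 3) (≤-trans (≤-reflexive (fuel-after-round (length ws))) p))

length-deck : ∀ n → length (deck n) ≡ n
length-deck n = trans (length-map suc (upTo n)) (length-upTo n)

deck-3+ : ∀ n → deck (3 + n) ≡ 1 ∷ 2 ∷ 3 ∷ map (3 +_) (deck n)
deck-3+ n = cong (λ ws → 1 ∷ 2 ∷ 3 ∷ ws) (begin
  map suc (applyUpTo (λ i → 3 + i) n)  ≡⟨ map-applyUpTo (3 +_) suc n ⟩
  applyUpTo (λ i → 3 + suc i) n        ≡⟨ map-applyUpTo suc (3 +_) n ⟨
  map (3 +_) (applyUpTo suc n)         ≡⟨ cong (map (3 +_)) (map-upTo suc n) ⟨
  map (3 +_) (deck n)                  ∎)

deck-∷ʳ : ∀ n → deck (suc n) ≡ deck n ∷ʳ suc n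
deck-∷ʳ n = trans (cong (map suc) (sym (upTo-∷ʳ n))) (map-++ suc (upTo n) [ n ])

-- Dealing UDD from a deck of N + 2 cards deals cards 2 and 3 and leaves the deck
-- 4, …, N + 2, 1; its card at position x was at position relabel N x.
relabel : ℕ → ℕ → ℕ
relabel N x = if does (x ≟ N) then 1 else 3 + x

relabel-self : ∀ N → relabel N N ≡ 1
relabel-self N rewrite dec-true (N ≟ N) refl = refl

relabel-≢ : ∀ {N x} → x ≢ N → relabel N x ≡ 3 + x
relabel-≢ {N} {x} x≢N rewrite dec-false (x ≟ N) x≢N = refl

relabel-deck : ∀ n → map (relabel (suc n)) (deck (suc n)) ≡ map (3 +_) (deck n) ∷ʳ 1
relabel-deck n = begin
  map r (deck (suc n))                      ≡⟨ cong (map r) (deck-∷ʳ n) ⟩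
  map r (deck n ∷ʳ suc n)                   ≡⟨ map-++ r (deck n) [ suc n ] ⟩
  map r (deck n) ∷ʳ r (suc n)               ≡⟨ cong₂ _∷ʳ_ shift (relabel-self (suc n)) ⟩
  map (3 +_) (deck n) ∷ʳ 1                  ∎
  where
  r = relabel (suc n)
  shift : map r (deck n) ≡ map (3 +_) (deck n)
  shift = begin
    map r (deck n)               ≡⟨ cong (map r) (map-upTo suc n) ⟩
    map r (applyUpTo suc n)      ≡⟨ map-cong-local (applyUpTo⁺₁ suc n (λ i<n → relabel-≢ (<⇒≢ (s≤s i<n)))) ⟩
    map (3 +_) (applyUpTo suc n) ≡⟨ cong (map (3 +_)) (map-upTo suc n) ⟨
    map (3 +_) (deck n)          ∎

-- The case N = 0 holds too, with both sides 1, because F-UDD 0 = 0.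
F-UDD-2+ : ∀ N → F-UDD (2 + N) ≡ relabel N (F-UDD N)
F-UDD-2+ zero = refl
F-UDD-2+ (suc n) = begin
  run UDD (3 + f) 0 (deck (3 + n)) 0
    ≡⟨ cong (λ ws → run UDD (3 + f) 0 ws 0) (deck-3+ n) ⟩
  run UDD (3 + f) 0 (1 ∷ 2 ∷ 3 ∷ map (3 +_) (deck n)) 0
    ≡⟨ run-UDD-round f 1 2 3 (map (3 +_) (deck n)) 0 ⟩
  run UDD f 0 (map (3 +_) (deck n) ∷ʳ 1) 3
    ≡⟨ cong (λ ws → run UDD f 0 ws 3) (relabel-deck n) ⟨
  run UDD f 0 (map (relabel N) (deck N)) (relabel N 0)
    ≡⟨ run-map UDD (relabel N) f 0 (deck N) 0 ⟩
  relabel N (run UDD f 0 (deck N) 0)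
    ≡⟨ cong (λ f → relabel N (run UDD f 0 (deck N) 0)) (fuel-after-round n) ⟨
  relabel N (run UDD (3 * N + 3) 0 (deck N) 0)
    ≡⟨ cong (relabel N) (run-UDD-fuel (3 * N) 3 (deck N) 0 (≤-reflexive (cong (3 *_) (length-deck N)))) ⟩
  relabel N (F-UDD N)
    ∎
  where
  N = suc n
  f = n + 2 * (3 + n)

m+2*[1+n]≡2+[m+2*n] : ∀ m n → m + 2 * suc n ≡ 2 + (m + 2 * n)
m+2*[1+n]≡2+[m+2*n] m n = begin
  m + 2 * suc n          ≡⟨ cong (m +_) (*-suc 2 n) ⟩
  m + (2 + 2 * n)        ≡⟨ +-suc m (1 + 2 * n) ⟩
  suc (m + (1 + 2 * n))  ≡⟨ cong suc (+-suc m (2 * n)) ⟩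
  2 + (m + 2 * n)        ∎

-- 1 + 3 * j is definitionally suc j + 2 * j, which the last steps here and in
-- F-UDD-triple rely on.
F-UDD-climb : ∀ {N j} → F-UDD N ≡ 1 → j < N → F-UDD (N + 2 * j) ≡ 1 + 3 * j
F-UDD-climb {N} {zero} F≡1 _ = trans (cong F-UDD (+-identityʳ N)) F≡1
F-UDD-climb {N} {suc j} F≡1 1+j<N = begin
  F-UDD (N + 2 * suc j)                    ≡⟨ cong F-UDD (m+2*[1+n]≡2+[m+2*n] N j) ⟩
  F-UDD (2 + (N + 2 * j))                  ≡⟨ F-UDD-2+ (N + 2 * j) ⟩
  relabel (N + 2 * j) (F-UDD (N + 2 * j))  ≡⟨ cong (relabel (N + 2 * j)) (F-UDD-climb {N} {j} F≡1 (<⇒≤ 1+j<N)) ⟩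
  relabel (N + 2 * j) (1 + 3 * j)          ≡⟨ relabel-≢ (<⇒≢ (+-monoˡ-< (2 * j) 1+j<N)) ⟩
  3 + (1 + 3 * j)                          ≡⟨ cong suc (*-suc 3 j) ⟨
  1 + 3 * suc j                            ∎

F-UDD-triple : ∀ {N} → F-UDD N ≡ 1 → F-UDD (3 * N) ≡ 1
F-UDD-triple {suc n} F≡1 = begin
  F-UDD (3 * suc n)                        ≡⟨ cong F-UDD (m+2*[1+n]≡2+[m+2*n] (suc n) n) ⟩
  F-UDD (2 + M)                            ≡⟨ F-UDD-2+ M ⟩
  relabel M (F-UDD M)                      ≡⟨ cong (relabel M) (F-UDD-climb {j = n} F≡1 ≤-refl) ⟩
  relabel M M                              ≡⟨ relabel-self M ⟩
  1                                        ∎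
  where M = suc n + 2 * n

-- S k is S^{UDD}(k + 1).
S : ℕ → ℕ
S 0 = 1
S 1 = 2
S (suc (suc k)) = 3 * S k

F-UDD-S : ∀ k → F-UDD (S k) ≡ 1
F-UDD-S 0 = refl
F-UDD-S 1 = refl
F-UDD-S (suc (suc k)) = F-UDD-triple {S k} (F-UDD-S k)

S-<-suc : ∀ k → S k < S (suc k)
S-<-suc 0 = s≤s (s≤s z≤n)
S-<-suc 1 = s≤s (s≤s (s≤s z≤n))
S-<-suc (suc (suc k)) = *-monoʳ-< 3 (S-<-suc k)

S-mono-≤ : ∀ {m n} → m ≤ n → S m ≤ S n
S-mono-≤ {n = zero} z≤n = ≤-refl
S-mono-≤ {n = suc n} m≤1+n with m≤n⇒m<n∨m≡n m≤1+n
... | inj₁ m<1+n = ≤-trans (S-mono-≤ (s≤s⁻¹ m<1+n)) (<⇒≤ (S-<-suc n))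
... | inj₂ refl = ≤-refl

S-cancel-< : ∀ {m n} → S m < S n → m < n
S-cancel-< Sm<Sn = ≰⇒> (λ n≤m → <⇒≱ Sm<Sn (S-mono-≤ n≤m))

S-positive : ∀ k → 1 ≤ S k
S-positive k = S-mono-≤ {0} {k} z≤n

S-blocks-cover : ∀ n → ∃₂ λ k j → j < S k × suc n ≡ S k + 2 * j
S-blocks-cover 0 = 0 , 0 , s≤s z≤n , refl
S-blocks-cover 1 = 1 , 0 , s≤s z≤n , refl
S-blocks-cover (suc (suc n)) with S-blocks-cover n
... | k , j , j<S , 1+n≡ with suc j <? S k
...   | yes 1+j<S = k , suc j , 1+j<S , trans (cong (2 +_) 1+n≡) (sym (m+2*[1+n]≡2+[m+2*n] (S k) j))
...   | no 1+j≮S = 2 + k , 0 , S-positive (2 + k) , (begin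
  2 + suc n              ≡⟨ cong (2 +_) 1+n≡ ⟩
  2 + (S k + 2 * j)      ≡⟨ cong (λ s → 2 + (s + 2 * j)) 1+j≡S ⟨
  2 + (suc j + 2 * j)    ≡⟨ m+2*[1+n]≡2+[m+2*n] (suc j) j ⟨
  3 * suc j              ≡⟨ cong (3 *_) 1+j≡S ⟩
  3 * S k                ≡⟨ +-identityʳ (3 * S k) ⟨
  S (2 + k) + 2 * 0      ∎)
  where
  1+j≡S : suc j ≡ S k
  1+j≡S = ≤-antisym j<S (≮⇒≥ 1+j≮S)

F-UDD≡1⇒S : ∀ {N} → F-UDD N ≡ 1 → ∃ λ k → N ≡ S k
F-UDD≡1⇒S {suc n} F≡1 with S-blocks-cover n
... | k , zero , _ , 1+n≡ = k , trans 1+n≡ (+-identityʳ (S k))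
... | k , suc j , j<S , 1+n≡ with trans (sym F≡1) (trans (cong F-UDD 1+n≡) (F-UDD-climb (F-UDD-S k) j<S))
...   | ()

F-UDD≢1-between : ∀ k {N} → S k < N → N < S (suc k) → F-UDD N ≢ 1
F-UDD≢1-between k {N} Sk<N N<S1+k F≡1 with F-UDD≡1⇒S {N} F≡1
... | m , refl = <⇒≱ (S-cancel-< {k} {m} Sk<N) (s≤s⁻¹ (S-cancel-< {m} {suc k} N<S1+k))

count1-suc-≡1 : ∀ n → F-UDD (suc n) ≡ 1 → count1 (suc n) ≡ suc (count1 n)
count1-suc-≡1 n F≡1 rewrite dec-true (F-UDD (suc n) ≟ 1) F≡1 = +-comm (count1 n) 1

count1-suc-≢1 : ∀ n → F-UDD (suc n) ≢ 1 → count1 (suc n) ≡ count1 n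
count1-suc-≢1 n F≢1 rewrite dec-false (F-UDD (suc n) ≟ 1) F≢1 = +-identityʳ (count1 n)

count1-gap : ∀ N d → (∀ i → i < d → F-UDD (suc (N + i)) ≢ 1) → count1 (N + d) ≡ count1 N
count1-gap N zero _ = cong count1 (+-identityʳ N)
count1-gap N (suc d) gap = begin
  count1 (N + suc d)    ≡⟨ cong count1 (+-suc N d) ⟩
  count1 (suc (N + d))  ≡⟨ count1-suc-≢1 (N + d) (gap d ≤-refl) ⟩
  count1 (N + d)        ≡⟨ count1-gap N d (λ i i<d → gap i (m<n⇒m<1+n i<d)) ⟩
  count1 N              ∎

count1-S : ∀ k → count1 (S k) ≡ suc k
count1-S zero = refl
count1-S (suc k) with m≤n⇒∃[o]m+o≡n (S-<-suc k)
... | o , 1+Sk+o≡ = begin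
  count1 (S (suc k))        ≡⟨ cong count1 1+Sk+o≡ ⟨
  count1 (suc (S k + o))    ≡⟨ count1-suc-≡1 (S k + o) (subst (λ M → F-UDD M ≡ 1) (sym 1+Sk+o≡) (F-UDD-S (suc k))) ⟩
  suc (count1 (S k + o))    ≡⟨ cong suc (count1-gap (S k) o no-S-between) ⟩
  suc (count1 (S k))        ≡⟨ cong suc (count1-S k) ⟩
  suc (suc k)               ∎
  where
  no-S-between : ∀ i → i < o → F-UDD (suc (S k + i)) ≢ 1
  no-S-between i i<o = F-UDD≢1-between k (s≤s (m≤m+n (S k) i))
                         (subst (suc (S k + i) <_) 1+Sk+o≡ (s≤s (+-monoʳ-< (S k) i<o)))

S-UDD-is-S : ∀ k → S-UDD-is (suc k) (S k)
S-UDD-is-S k = S-positive k , F-UDD-S k , count1-S k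

S-even : ∀ m → S (2 * m) ≡ 3 ^ m
S-even zero = refl
S-even (suc m) = trans (cong S (*-suc 2 m)) (cong (3 *_) (S-even m))

S-odd : ∀ m → S (2 * m + 1) ≡ 2 * 3 ^ m
S-odd zero = refl
S-odd (suc m) = begin
  S (2 * suc m + 1)    ≡⟨ cong (λ n → S (n + 1)) (*-suc 2 m) ⟩
  3 * S (2 * m + 1)    ≡⟨ cong (3 *_) (S-odd m) ⟩
  3 * (2 * 3 ^ m)      ≡⟨ *-assoc 3 2 (3 ^ m) ⟨
  6 * 3 ^ m            ≡⟨ *-assoc 2 3 (3 ^ m) ⟩
  2 * 3 ^ suc m        ∎

mainTheorem19 : ((m : ℕ) → S-UDD-is (2 * m + 1) (3 ^ m))
    × ((m : ℕ) → 1 ≤ m → S-UDD-is (2 * m) (2 * 3 ^ (m ∸ 1)))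
mainTheorem19 = odd-index , even-index
  where
  odd-index : (m : ℕ) → S-UDD-is (2 * m + 1) (3 ^ m)
  odd-index m = subst₂ S-UDD-is (+-comm 1 (2 * m)) (S-even m) (S-UDD-is-S (2 * m))

  even-index : (m : ℕ) → 1 ≤ m → S-UDD-is (2 * m) (2 * 3 ^ (m ∸ 1))
  even-index (suc m) _ = subst₂ S-UDD-is (trans (cong suc (+-comm (2 * m) 1)) (sym (*-suc 2 m)))
                           (S-odd m) (S-UDD-is-S (2 * m + 1))
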